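{- Let $P=(X,\prec)$ be a finite poset with $|X|=n$ elements. Then for every $t\in\mathbb N$, $$\Omega(P,t)\ \geq\ \frac{e(P)\,t^n}{n!}.$$
   Context: $\Omega(P,t)$ is the number of maps $g:X\to[t]=\{1,\dots,t\}$ with $g(x)\le g(y)$ whenever $x\prec y$. $e(P)$ is the number of linear extensions of $P$, i.e. bijections $f:X\to[n]$ with $f(x)<f(y)$ whenever $x\prec y$. -}

module Defs where

open import Data.Nat using (ℕ; zero; suc; _≤_; _<_)
open import Data.Nat.Properties using (_≤?_; _<?_)
open import Data.Fin using (Fin; zero; suc; toℕ; _≟_)
open import Data.Fin.Properties using (all?; any?)
open import Data.List using (List; []; _∷_; map; concatMap; filter; length)
open import Data.Product using (_×_; _,_; ∃)
open import Relation.Nullary using (Dec; yes; no; ¬_)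
open import Relation.Nullary.Decidable using (_×-dec_; _→-dec_; ¬?)
open import Relation.Binary using (Rel; Decidable; IsStrictPartialOrder)
open import Relation.Binary.PropositionalEquality using (_≡_)
open import Level using (0ℓ)

allFins : (t : ℕ) → List (Fin t)
allFins zero    = []
allFins (suc t) = zero ∷ map suc (allFins t)

cons : ∀ {n t} → Fin t → (Fin n → Fin t) → (Fin (suc n) → Fin t)
cons a g zero    = a
cons a g (suc i) = g i

allFuns : (n t : ℕ) → List (Fin n → Fin t)
allFuns zero    t = (λ ()) ∷ []
allFuns (suc n) t = concatMap (λ a → map (cons a) (allFuns n t)) (allFins t)

module _ {n : ℕ} (_≺_ : Rel (Fin n) 0ℓ) (_≺?_ : Decidable _≺_) where

  IsOrderPreserving : ∀ {t} → (Fin n → Fin t) → Set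
  IsOrderPreserving g = ∀ x y → x ≺ y → toℕ (g x) ≤ toℕ (g y)

  isOrderPreserving? : ∀ {t} (g : Fin n → Fin t) → Dec (IsOrderPreserving g)
  isOrderPreserving? g = all? λ x → all? λ y → (x ≺? y) →-dec (toℕ (g x) ≤? toℕ (g y))

  Ω : ℕ → ℕ
  Ω t = length (filter isOrderPreserving? (allFuns n t))

  Injective : (Fin n → Fin n) → Set
  Injective f = ∀ x y → f x ≡ f y → x ≡ y

  Surjective : (Fin n → Fin n) → Set
  Surjective f = ∀ k → ∃ λ x → f x ≡ k

  IsLinearExtension : (Fin n → Fin n) → Set
  IsLinearExtension f =
    Injective f × Surjective f × (∀ x y → x ≺ y → toℕ (f x) < toℕ (f y))

  isLinearExtension? : (f : Fin n → Fin n) → Dec (IsLinearExtension f)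
  isLinearExtension? f =
    (all? λ x → all? λ y → (f x ≟ f y) →-dec (x ≟ y))
    ×-dec (all? λ k → any? λ x → f x ≟ k)
    ×-dec (all? λ x → all? λ y → (x ≺? y) →-dec (toℕ (f x) <? toℕ (f y)))

  e : ℕ
  e = length (filter isLinearExtension? (allFuns n n))

{-# OPTIONS --safe #-}
-- Call a pair (h, ρ) of a map h : [n] → [t] and a permutation ρ of [n] sorted if
-- i ↦ (h i, ρ i) is lexicographically increasing, and let D be the set of sorted pairs.
-- Listing [n] in increasing order of (h x, x) turns each of the t^n maps h into a different
-- sorted pair, so t^n ≤ |D|. A linear extension L together with (h, ρ) ∈ D gives the
-- order-preserving map h ∘ L and the permutation ρ ∘ L; this is injective because L is
-- recovered as the ordering of X by the key x ↦ (h (L x), ρ (L x)). So e(P) |D| ≤ Ω(P,t) n!.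
module Submission where

open import Level using (Level; 0ℓ)
open import Function using (_∘_)
open import Function.Definitions using (Injective; StrictlySurjective)
open import Data.Nat using (ℕ; zero; suc; _+_; _*_; _^_; _≤_; _<_; s≤s; z≤n; _!)
import Data.Nat.Properties as ℕ
open import Data.Nat.Properties
  using (_<?_; <-cmp; <-irrefl; <-asym; ≤-refl; n<1+n; m≤n⇒m≤1+n; <-≤-trans; ≤-<-trans; *-monoʳ-≤)
open import Data.Fin using (Fin; zero; suc; toℕ; fromℕ<; punchOut; combine; _≟_)
  renaming (_<_ to _<ᶠ_; _≤_ to _≤ᶠ_)
import Data.Fin.Properties as Fin
open import Data.Fin.Properties
  using (all?; any?; 0≢1+n; punchOut-cong; punchOut-injective; suc-injective; toℕ-fromℕ<; toℕ-injective)
open import Data.List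
  using (List; []; _∷_; _++_; length; map; lookup; filter; concatMap; allFin;
         cartesianProductWith; cartesianProduct)
open import Data.List.Properties using (length-map; length-++; length-filter; length-tabulate; map-tabulate)
open import Data.List.Relation.Unary.Any using (index; here)
import Data.List.Relation.Unary.All as All
open import Data.List.Relation.Unary.AllPairs using ([]; _∷_)
open import Data.List.Relation.Unary.Unique.Setoid using (Unique)
import Data.List.Relation.Unary.Unique.Setoid.Properties as Unique
open import Data.List.Relation.Unary.Unique.Propositional.Properties using (allFin⁺)
open import Data.List.Membership.Propositional using (_∈_)
open import Data.List.Membership.Propositional.Properties
  using (∈-lookup; ∈-filter⁻; ∈-cartesianProduct⁻; ∈-allFin)
import Data.List.Membership.Setoid as Membership
import Data.List.Membership.Setoid.Properties as Membership
open import Data.Product using (_×_; _,_; proj₁; proj₂)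
open import Data.Product.Relation.Binary.Pointwise.NonDependent using (_×ₛ_)
open import Relation.Binary using (Setoid; Rel; Decidable; IsStrictPartialOrder; tri<; tri≈; tri>)
open import Relation.Binary.PropositionalEquality
  using (_≡_; _≢_; _≗_; refl; sym; trans; cong; cong₂; subst; subst₂; _→-setoid_; module ≡-Reasoning)
import Relation.Binary.PropositionalEquality.Properties as ≡
open import Relation.Nullary using (Dec; yes; no; map′; contradiction)
open import Relation.Nullary.Decidable using (_→-dec_)

open import Defs
  using (allFins; allFuns; cons; IsOrderPreserving; isOrderPreserving?; IsLinearExtension; isLinearExtension?;
         Ω; e)

private variable
  a b ℓ ℓ₁ ℓ₂ : Level
  A B C : Set a

∈-syntax : (S : Setoid a ℓ) → Setoid.Carrier S → List (Setoid.Carrier S) → Set _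
∈-syntax = Membership._∈_
infix 4 ∈-syntax
syntax ∈-syntax S x xs = x ∈[ S ] xs

≈-syntax : (S : Setoid a ℓ) → Setoid.Carrier S → Setoid.Carrier S → Set _
≈-syntax = Setoid._≈_
infix 4 ≈-syntax
syntax ≈-syntax S x y = x ≈[ S ] y

length-cartesianProductWith : (f : A → B → C) (xs : List A) (ys : List B) →
  length (cartesianProductWith f xs ys) ≡ length xs * length ys
length-cartesianProductWith f []       ys = refl
length-cartesianProductWith f (x ∷ xs) ys = trans (length-++ (map (f x) ys))
  (cong₂ _+_ (length-map (f x) ys) (length-cartesianProductWith f xs ys))

concatMap-map≡cartesianProductWith : (f : A → B → C) (xs : List A) (ys : List B) →
  concatMap (λ x → map (f x) ys) xs ≡ cartesianProductWith f xs ys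
concatMap-map≡cartesianProductWith f []       ys = refl
concatMap-map≡cartesianProductWith f (x ∷ xs) ys =
  cong (map (f x) ys ++_) (concatMap-map≡cartesianProductWith f xs ys)

module _ (S : Setoid a ℓ) where
  open Setoid S using (_≈_) renaming (sym to ≈-sym)

  Unique⇒lookup-injective : ∀ {xs} → Unique S xs → ∀ {i j} → lookup xs i ≈ lookup xs j → i ≡ j
  Unique⇒lookup-injective {x ∷ xs} _   {zero}  {zero}  _   = refl
  Unique⇒lookup-injective {x ∷ xs} xs! {zero}  {suc j} x≈  = contradiction
    (Membership.∈-resp-≈ S (≈-sym x≈) (Membership.∈-lookup S xs j)) (Unique.Unique[x∷xs]⇒x∉xs S xs!)
  Unique⇒lookup-injective {x ∷ xs} xs! {suc i} {zero}  ≈x  = contradiction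
    (Membership.∈-resp-≈ S ≈x (Membership.∈-lookup S xs i)) (Unique.Unique[x∷xs]⇒x∉xs S xs!)
  Unique⇒lookup-injective {x ∷ xs} (_ ∷ xs!) {suc i} {suc j} eq = cong suc (Unique⇒lookup-injective xs! eq)

length-≤-by-injection : (S : Setoid a ℓ₁) (T : Setoid b ℓ₂) {xs : List (Setoid.Carrier S)}
  {ys : List (Setoid.Carrier T)} (f : Setoid.Carrier S → Setoid.Carrier T) → Unique S xs →
  (∀ {x} → x ∈ xs → f x ∈[ T ] ys) →
  (∀ {x y} → x ∈ xs → y ∈ xs → f x ≈[ T ] f y → x ≈[ S ] y) →
  length xs ≤ length ys
length-≤-by-injection S T {xs} f xs! into injective = Fin.injective⇒≤ position-injective
  where
  position : Fin (length xs) → Fin _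
  position i = index (into (∈-lookup i))
  position-injective : ∀ {i j} → position i ≡ position j → i ≡ j
  position-injective {i} {j} eq = Unique⇒lookup-injective S xs!
    (injective (∈-lookup i) (∈-lookup j) (Membership.index-injective T (into _) (into _) eq))

Fun : ℕ → ℕ → Setoid _ _
Fun n t = Fin n →-setoid Fin t

allFins≡allFin : ∀ t → allFins t ≡ allFin t
allFins≡allFin zero    = refl
allFins≡allFin (suc t) =
  cong (zero ∷_) (trans (cong (map suc) (allFins≡allFin t)) (map-tabulate (λ i → i) suc))

allFuns-suc : ∀ n t → allFuns (suc n) t ≡ cartesianProductWith cons (allFin t) (allFuns n t)
allFuns-suc n t = trans (concatMap-map≡cartesianProductWith cons (allFins t) (allFuns n t))
  (cong (λ as → cartesianProductWith cons as (allFuns n t)) (allFins≡allFin t))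

length-allFuns : ∀ n t → length (allFuns n t) ≡ t ^ n
length-allFuns zero    t = refl
length-allFuns (suc n) t = begin
  length (allFuns (suc n) t)
    ≡⟨ cong length (allFuns-suc n t) ⟩
  length (cartesianProductWith cons (allFin t) (allFuns n t))
    ≡⟨ length-cartesianProductWith cons (allFin t) (allFuns n t) ⟩
  length (allFin t) * length (allFuns n t)
    ≡⟨ cong₂ _*_ (length-tabulate {n = t} (λ i → i)) (length-allFuns n t) ⟩
  t * t ^ n
    ∎
  where open ≡-Reasoning

cons-injective : ∀ {n t} {a b : Fin t} {g h : Fin n → Fin t} → cons a g ≗ cons b h → a ≡ b × g ≗ h
cons-injective eq = eq zero , λ i → eq (suc i)

cons-cong : ∀ {n t} {a b : Fin t} {g h : Fin n → Fin t} → a ≡ b → g ≗ h → cons a g ≗ cons b h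
cons-cong a≡b g≗h zero    = a≡b
cons-cong a≡b g≗h (suc i) = g≗h i

allFuns-unique : ∀ n t → Unique (Fun n t) (allFuns n t)
allFuns-unique zero    t = All.[] ∷ []
allFuns-unique (suc n) t = subst (Unique (Fun (suc n) t)) (sym (allFuns-suc n t))
  (Unique.cartesianProductWith⁺ (≡.setoid (Fin t)) (Fun n t) (Fun (suc n) t) cons cons-injective
    (allFin⁺ t) (allFuns-unique n t))

∈-allFuns : ∀ n t (f : Fin n → Fin t) → f ∈[ Fun n t ] allFuns n t
∈-allFuns zero    t f = here (λ ())
∈-allFuns (suc n) t f = subst (λ fs → f ∈[ Fun (suc n) t ] fs) (sym (allFuns-suc n t))
  (Membership.∈-resp-≈ (Fun (suc n) t) (λ i → sym (f≗cons i))
    (Membership.∈-cartesianProductWith⁺ (≡.setoid (Fin t)) (Fun n t) (Fun (suc n) t) cons-cong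
      (∈-allFin (f zero)) (∈-allFuns n t (f ∘ suc))))
  where
  f≗cons : f ≗ cons (f zero) (f ∘ suc)
  f≗cons zero    = refl
  f≗cons (suc i) = refl

IsInjection : {A B : Set} → (A → B) → Set
IsInjection f = Injective _≡_ _≡_ f

injective? : ∀ {m n} (f : Fin m → Fin n) → Dec (IsInjection f)
injective? f = map′ (λ inj {x} {y} → inj x y) (λ inj x y → inj)
  (all? λ x → all? λ y → (f x ≟ f y) →-dec (x ≟ y))

injective-resp-≗ : ∀ {m n} {f g : Fin m → Fin n} → f ≗ g → IsInjection f → IsInjection g
injective-resp-≗ f≗g inj {x} {y} gx≡gy = inj (trans (f≗g x) (trans gx≡gy (sym (f≗g y))))

injective⇒surjective : ∀ {n} {f : Fin n → Fin n} → IsInjection f → StrictlySurjective _≡_ f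
injective⇒surjective {suc n} {f} inj k with any? (λ x → f x ≟ k)
... | yes hit  = hit
... | no  miss = contradiction (Fin.injective⇒≤ punchedOut-injective) (<-irrefl refl)
  where
  k≢f : ∀ x → k ≢ f x
  k≢f x k≡fx = miss (x , sym k≡fx)
  punchedOut-injective : IsInjection (λ x → punchOut (k≢f x))
  punchedOut-injective eq = inj (punchOut-injective (k≢f _) (k≢f _) eq)

permutations : ∀ n → List (Fin n → Fin n)
permutations n = filter injective? (allFuns n n)

permutations-unique : ∀ n → Unique (Fun n n) (permutations n)
permutations-unique n = Unique.filter⁺ (Fun n n) injective? (allFuns-unique n n)

∈-permutations : ∀ {n} {σ : Fin n → Fin n} → IsInjection σ → σ ∈[ Fun n n ] permutations n
∈-permutations {n} {σ} =
  Membership.∈-filter⁺ (Fun n n) injective? injective-resp-≗ (∈-allFuns n n σ)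

∈-permutations⁻ : ∀ {n} {σ : Fin n → Fin n} → σ ∈ permutations n → IsInjection σ
∈-permutations⁻ {n} σ∈ = proj₂ (∈-filter⁻ injective? {xs = allFuns n n} σ∈)

-- The value at i is junk when σ 0 ≡ σ (1 + i), which cannot happen for an injective σ.
removeHead : ∀ {n} → (Fin (suc n) → Fin (suc n)) → Fin n → Fin n
removeHead σ i with σ zero ≟ σ (suc i)
... | yes _       = i
... | no  σ₀≢σ₁₊ᵢ = punchOut σ₀≢σ₁₊ᵢ

removeHead-punchOut : ∀ {n} (σ : Fin (suc n) → Fin (suc n)) {i} (σ₀≢σ₁₊ᵢ : σ zero ≢ σ (suc i)) →
  removeHead σ i ≡ punchOut σ₀≢σ₁₊ᵢ
removeHead-punchOut σ {i} σ₀≢σ₁₊ᵢ with σ zero ≟ σ (suc i)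
... | yes σ₀≡σ₁₊ᵢ = contradiction σ₀≡σ₁₊ᵢ σ₀≢σ₁₊ᵢ
... | no  _       = punchOut-cong (σ zero) refl

head≢tail : ∀ {n} {σ : Fin (suc n) → Fin (suc n)} → IsInjection σ → ∀ i → σ zero ≢ σ (suc i)
head≢tail inj i σ₀≡σ₁₊ᵢ = 0≢1+n (inj σ₀≡σ₁₊ᵢ)

removeHead-injective : ∀ {n} {σ : Fin (suc n) → Fin (suc n)} → IsInjection σ → IsInjection (removeHead σ)
removeHead-injective {σ = σ} inj {i} {j} eq =
  suc-injective (inj (punchOut-injective σ₀≢σ₁₊ᵢ σ₀≢σ₁₊ⱼ
    (trans (sym (removeHead-punchOut σ σ₀≢σ₁₊ᵢ)) (trans eq (removeHead-punchOut σ σ₀≢σ₁₊ⱼ)))))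
  where
  σ₀≢σ₁₊ᵢ = head≢tail inj i
  σ₀≢σ₁₊ⱼ = head≢tail inj j

punchOut-injective′ : ∀ {n} {i i′ j k : Fin (suc n)} → i ≡ i′ →
  (i≢j : i ≢ j) (i′≢k : i′ ≢ k) → punchOut i≢j ≡ punchOut i′≢k → j ≡ k
punchOut-injective′ refl = punchOut-injective

head-removeHead-injective : ∀ {n} {σ τ : Fin (suc n) → Fin (suc n)} → IsInjection σ → IsInjection τ →
  σ zero ≡ τ zero → removeHead σ ≗ removeHead τ → σ ≗ τ
head-removeHead-injective σ-inj τ-inj σ₀≡τ₀ eq zero    = σ₀≡τ₀
head-removeHead-injective {σ = σ} {τ} σ-inj τ-inj σ₀≡τ₀ eq (suc i) =
  punchOut-injective′ σ₀≡τ₀ σ₀≢σ₁₊ᵢ τ₀≢τ₁₊ᵢ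
    (trans (sym (removeHead-punchOut σ σ₀≢σ₁₊ᵢ)) (trans (eq i) (removeHead-punchOut τ τ₀≢τ₁₊ᵢ)))
  where
  σ₀≢σ₁₊ᵢ = head≢tail σ-inj i
  τ₀≢τ₁₊ᵢ = head≢tail τ-inj i

length-permutations : ∀ n → length (permutations n) ≤ n !
length-permutations zero    = length-filter injective? (allFuns 0 0)
length-permutations (suc n) = begin
  length (permutations (suc n))
    ≤⟨ length-≤-by-injection (Fun (suc n) (suc n)) HeadTail split (permutations-unique (suc n)) into injective ⟩
  length (cartesianProduct (allFin (suc n)) (permutations n))
    ≡⟨ length-cartesianProductWith _,_ (allFin (suc n)) (permutations n) ⟩
  length (allFin (suc n)) * length (permutations n)
    ≡⟨ cong (_* length (permutations n)) (length-tabulate {n = suc n} (λ i → i)) ⟩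
  suc n * length (permutations n)
    ≤⟨ *-monoʳ-≤ (suc n) (length-permutations n) ⟩
  suc n * n !
    ∎
  where
  open ℕ.≤-Reasoning
  HeadTail = ≡.setoid (Fin (suc n)) ×ₛ Fun n n
  split : (Fin (suc n) → Fin (suc n)) → Fin (suc n) × (Fin n → Fin n)
  split σ = σ zero , removeHead σ
  into : ∀ {σ} → σ ∈ permutations (suc n) →
    split σ ∈[ HeadTail ] cartesianProduct (allFin (suc n)) (permutations n)
  into {σ} σ∈ = Membership.∈-cartesianProduct⁺ (≡.setoid (Fin (suc n))) (Fun n n)
    (∈-allFin (σ zero)) (∈-permutations (removeHead-injective (∈-permutations⁻ σ∈)))
  injective : ∀ {σ τ} → σ ∈ permutations (suc n) → τ ∈ permutations (suc n) →
    split σ ≈[ HeadTail ] split τ → σ ≗ τ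
  injective σ∈ τ∈ (σ₀≡τ₀ , eq) =
    head-removeHead-injective (∈-permutations⁻ σ∈) (∈-permutations⁻ τ∈) σ₀≡τ₀ eq

countBelow : ∀ {n} → (Fin n → ℕ) → ℕ → ℕ
countBelow {zero}  K k = 0
countBelow {suc n} K k with K zero <? k
... | yes _ = suc (countBelow (K ∘ suc) k)
... | no  _ = countBelow (K ∘ suc) k

countBelow-≤ : ∀ {n} (K : Fin n → ℕ) k → countBelow K k ≤ n
countBelow-≤ {zero}  K k = z≤n
countBelow-≤ {suc n} K k with K zero <? k
... | yes _ = s≤s (countBelow-≤ (K ∘ suc) k)
... | no  _ = m≤n⇒m≤1+n (countBelow-≤ (K ∘ suc) k)

countBelow-mono : ∀ {n} (K : Fin n → ℕ) {k k′} → k ≤ k′ → countBelow K k ≤ countBelow K k′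
countBelow-mono {zero}  K k≤k′ = z≤n
countBelow-mono {suc n} K {k} {k′} k≤k′ with K zero <? k | K zero <? k′
... | yes _    | yes _    = s≤s (countBelow-mono (K ∘ suc) k≤k′)
... | yes K₀<k | no K₀≮k′ = contradiction (<-≤-trans K₀<k k≤k′) K₀≮k′
... | no  _    | yes _    = m≤n⇒m≤1+n (countBelow-mono (K ∘ suc) k≤k′)
... | no  _    | no  _    = countBelow-mono (K ∘ suc) k≤k′

countBelow-strict : ∀ {n} (K : Fin n → ℕ) {k k′} x → k ≤ K x → K x < k′ →
  countBelow K k < countBelow K k′
countBelow-strict {suc n} K {k} {k′} x k≤Kx Kx<k′ with K zero <? k | K zero <? k′ | x
... | _        | no K₀≮k′ | zero  = contradiction Kx<k′ K₀≮k′
... | yes K₀<k | _        | zero  = contradiction k≤Kx (ℕ.<⇒≱ K₀<k)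
... | no  _    | yes _    | zero  = s≤s (countBelow-mono (K ∘ suc) (ℕ.≤-trans k≤Kx (ℕ.<⇒≤ Kx<k′)))
... | yes _    | yes _    | suc y = s≤s (countBelow-strict (K ∘ suc) y k≤Kx Kx<k′)
... | yes K₀<k | no K₀≮k′ | suc y = contradiction (ℕ.<-trans K₀<k (≤-<-trans k≤Kx Kx<k′)) K₀≮k′
... | no  _    | yes _    | suc y = m≤n⇒m≤1+n (countBelow-strict (K ∘ suc) y k≤Kx Kx<k′)
... | no  _    | no  _    | suc y = countBelow-strict (K ∘ suc) y k≤Kx Kx<k′

module _ {n} (K : Fin n → ℕ) where

  rank : Fin n → ℕ
  rank x = countBelow K (K x)

  rank<n : ∀ x → rank x < n
  rank<n x = <-≤-trans (countBelow-strict K x ≤-refl (n<1+n (K x))) (countBelow-≤ K (suc (K x)))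

  rank-mono-< : ∀ {x y} → K x < K y → rank x < rank y
  rank-mono-< {x} = countBelow-strict K x ≤-refl

  rank-cancel-< : ∀ {x y} → rank x < rank y → K x < K y
  rank-cancel-< {x} {y} rx<ry with <-cmp (K x) (K y)
  ... | tri< Kx<Ky _ _ = Kx<Ky
  ... | tri≈ _ Kx≡Ky _ = contradiction rx<ry (<-irrefl (cong (countBelow K) Kx≡Ky))
  ... | tri> _ _ Ky<Kx = contradiction rx<ry (<-asym (rank-mono-< Ky<Kx))

  rank-cancel-≡ : ∀ {x y} → rank x ≡ rank y → K x ≡ K y
  rank-cancel-≡ {x} {y} rx≡ry with <-cmp (K x) (K y)
  ... | tri< Kx<Ky _ _ = contradiction rx≡ry (ℕ.<⇒≢ (rank-mono-< Kx<Ky))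
  ... | tri≈ _ Kx≡Ky _ = Kx≡Ky
  ... | tri> _ _ Ky<Kx = contradiction (sym rx≡ry) (ℕ.<⇒≢ (rank-mono-< Ky<Kx))

  rankFin : Fin n → Fin n
  rankFin x = fromℕ< (rank<n x)

  rankFin-injective : IsInjection K → IsInjection rankFin
  rankFin-injective K-inj {x} {y} eq = K-inj (rank-cancel-≡
    (trans (sym (toℕ-fromℕ< (rank<n x))) (trans (cong toℕ eq) (toℕ-fromℕ< (rank<n y)))))

  sortBy : IsInjection K → Fin n → Fin n
  sortBy K-inj i = proj₁ (injective⇒surjective (rankFin-injective K-inj) i)

  module _ (K-inj : IsInjection K) where

    rankFin-sortBy : ∀ i → rankFin (sortBy K-inj i) ≡ i
    rankFin-sortBy i = proj₂ (injective⇒surjective (rankFin-injective K-inj) i)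

    sortBy-injective : IsInjection (sortBy K-inj)
    sortBy-injective {i} {j} eq =
      trans (sym (rankFin-sortBy i)) (trans (cong rankFin eq) (rankFin-sortBy j))

    sortBy-increasing : ∀ {i j} → i <ᶠ j → K (sortBy K-inj i) < K (sortBy K-inj j)
    sortBy-increasing {i} {j} i<j = rank-cancel-< (subst₂ _<_ (rank-sortBy i) (rank-sortBy j) i<j)
      where
      rank-sortBy : ∀ i → toℕ i ≡ rank (sortBy K-inj i)
      rank-sortBy i = trans (cong toℕ (sym (rankFin-sortBy i))) (toℕ-fromℕ< _)

StrictlyIncreasing : ∀ {n m} → (Fin n → Fin m) → Set
StrictlyIncreasing f = ∀ {i j} → i <ᶠ j → f i <ᶠ f j

strictlyIncreasing? : ∀ {n m} (f : Fin n → Fin m) → Dec (StrictlyIncreasing f)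
strictlyIncreasing? f = map′ (λ incr {i} {j} → incr i j) (λ incr i j → incr)
  (all? λ i → all? λ j → (i Fin.<? j) →-dec (f i Fin.<? f j))

module _ {n m} {f : Fin n → Fin m} (f-incr : StrictlyIncreasing f) where

  strictlyIncreasing-cancel-< : ∀ {i j} → f i <ᶠ f j → i <ᶠ j
  strictlyIncreasing-cancel-< {i} {j} fi<fj with Fin.<-cmp i j
  ... | tri< i<j _ _  = i<j
  ... | tri≈ _ refl _ = contradiction fi<fj (<-irrefl refl)
  ... | tri> _ _ j<i  = contradiction fi<fj (<-asym (f-incr j<i))

  strictlyIncreasing-mono-≤ : ∀ {i j} → i ≤ᶠ j → f i ≤ᶠ f j
  strictlyIncreasing-mono-≤ {i} {j} i≤j with Fin.<-cmp i j
  ... | tri< i<j _ _  = ℕ.<⇒≤ (f-incr i<j)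
  ... | tri≈ _ refl _ = ≤-refl
  ... | tri> _ _ j<i  = contradiction i≤j (ℕ.<⇒≱ j<i)

  strictlyIncreasing-injective : IsInjection f
  strictlyIncreasing-injective {i} {j} fi≡fj with Fin.<-cmp i j
  ... | tri< i<j _ _ = contradiction fi≡fj (Fin.<⇒≢ (f-incr i<j))
  ... | tri≈ _ i≡j _ = i≡j
  ... | tri> _ _ j<i = contradiction (sym fi≡fj) (Fin.<⇒≢ (f-incr j<i))

strictlyIncreasing⇒≤ : ∀ {n} {f : Fin n → Fin n} → StrictlyIncreasing f → ∀ i → i ≤ᶠ f i
strictlyIncreasing⇒≤ f-incr i with Fin.injective⇒existsPivot (strictlyIncreasing-injective f-incr) i
... | j , j≤i , i≤fj = ℕ.≤-trans i≤fj (strictlyIncreasing-mono-≤ f-incr j≤i)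

-- L′ ∘ L⁻¹ is strictly increasing, so it lies above the identity.
≤-of-order-preserving : ∀ {n} {L L′ : Fin n → Fin n} → IsInjection L → StrictlySurjective _≡_ L →
  (∀ {x y} → L x <ᶠ L y → L′ x <ᶠ L′ y) → ∀ x → L x ≤ᶠ L′ x
≤-of-order-preserving {L = L} {L′} L-inj L-surj L⇒L′ x =
  subst (λ z → L x ≤ᶠ L′ z) (L-inj (L∘L⁻¹ (L x))) (strictlyIncreasing⇒≤ increasing (L x))
  where
  L⁻¹ = λ k → proj₁ (L-surj k)
  L∘L⁻¹ = λ k → proj₂ (L-surj k)
  increasing : StrictlyIncreasing (L′ ∘ L⁻¹)
  increasing {i} {j} i<j = L⇒L′ (subst₂ _<ᶠ_ (sym (L∘L⁻¹ i)) (sym (L∘L⁻¹ j)) i<j)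

order-equivalent-bijections-≗ : ∀ {n} {L L′ : Fin n → Fin n} →
  IsInjection L → StrictlySurjective _≡_ L → IsInjection L′ → StrictlySurjective _≡_ L′ →
  (∀ {x y} → L x <ᶠ L y → L′ x <ᶠ L′ y) → (∀ {x y} → L′ x <ᶠ L′ y → L x <ᶠ L y) → L ≗ L′
order-equivalent-bijections-≗ L-inj L-surj L′-inj L′-surj L⇒L′ L′⇒L x = Fin.≤-antisym
  (≤-of-order-preserving L-inj L-surj L⇒L′ x) (≤-of-order-preserving L′-inj L′-surj L′⇒L x)

combine-cancelˡ-< : ∀ {t n} {i j : Fin t} {k l : Fin n} → combine i k <ᶠ combine j l → i ≤ᶠ j
combine-cancelˡ-< {k = k} {l} ik<jl = ℕ.≮⇒≥ λ j<i → <-asym ik<jl (Fin.combine-monoˡ-< l k j<i)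

-- combine encodes (h i, ρ i) so that its order on Fin (t * n) is the lexicographic one.
lexKey : ∀ {n t} → (Fin n → Fin t) → (Fin n → Fin n) → Fin n → Fin (t * n)
lexKey h ρ i = combine (h i) (ρ i)

lexKey-injective : ∀ {n t} (h : Fin n → Fin t) {ρ : Fin n → Fin n} → IsInjection ρ → IsInjection (lexKey h ρ)
lexKey-injective h {ρ} ρ-inj {i} {j} eq = ρ-inj (Fin.combine-injectiveʳ (h i) (ρ i) (h j) (ρ j) eq)

IsSorted : ∀ {n t} → (Fin n → Fin t) × (Fin n → Fin n) → Set
IsSorted (h , ρ) = StrictlyIncreasing (lexKey h ρ)

isSorted? : ∀ {n t} (p : (Fin n → Fin t) × (Fin n → Fin n)) → Dec (IsSorted p)
isSorted? (h , ρ) = strictlyIncreasing? (lexKey h ρ)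

FunPerm : ℕ → ℕ → Setoid _ _
FunPerm n t = Fun n t ×ₛ Fun n n

isSorted-resp-≈ : ∀ {n t} {p q} → p ≈[ FunPerm n t ] q → IsSorted p → IsSorted q
isSorted-resp-≈ (h≗h′ , ρ≗ρ′) sorted {i} {j} i<j = subst₂ _<ᶠ_ (key≗ i) (key≗ j) (sorted i<j)
  where key≗ = λ x → cong₂ combine (h≗h′ x) (ρ≗ρ′ x)

sortedPairs : ∀ n t → List ((Fin n → Fin t) × (Fin n → Fin n))
sortedPairs n t = filter isSorted? (cartesianProduct (allFuns n t) (permutations n))

sortedPairs-unique : ∀ n t → Unique (FunPerm n t) (sortedPairs n t)
sortedPairs-unique n t = Unique.filter⁺ (FunPerm n t) isSorted?
  (Unique.cartesianProduct⁺ (Fun n t) (Fun n n) (allFuns-unique n t) (permutations-unique n))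

∈-sortedPairs : ∀ {n t} {h ρ} → IsInjection ρ → IsSorted (h , ρ) → (h , ρ) ∈[ FunPerm n t ] sortedPairs n t
∈-sortedPairs {n} {t} {h} ρ-inj = Membership.∈-filter⁺ (FunPerm n t) isSorted? isSorted-resp-≈
  (Membership.∈-cartesianProduct⁺ (Fun n t) (Fun n n) (∈-allFuns n t h) (∈-permutations ρ-inj))

∈-sortedPairs⁻ : ∀ {n t} {h ρ} → (h , ρ) ∈ sortedPairs n t → IsInjection ρ × IsSorted (h , ρ)
∈-sortedPairs⁻ {n} {t} hρ∈ with ∈-filter⁻ isSorted? {xs = cartesianProduct (allFuns n t) (permutations n)} hρ∈
... | hρ∈′ , sorted =
  ∈-permutations⁻ (proj₂ (∈-cartesianProduct⁻ (allFuns n t) (permutations n) hρ∈′)) , sorted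

t^n≤length-sortedPairs : ∀ n t → t ^ n ≤ length (sortedPairs n t)
t^n≤length-sortedPairs n t = begin
  t ^ n                    ≡⟨ sym (length-allFuns n t) ⟩
  length (allFuns n t)     ≤⟨ length-≤-by-injection (Fun n t) (FunPerm n t) sorting
                                (allFuns-unique n t) into injective ⟩
  length (sortedPairs n t) ∎
  where
  open ℕ.≤-Reasoning
  key-injective : (h : Fin n → Fin t) → IsInjection (toℕ ∘ lexKey h (λ x → x))
  key-injective h eq = lexKey-injective h (λ x≡y → x≡y) (toℕ-injective eq)
  σ : (Fin n → Fin t) → Fin n → Fin n
  σ h = sortBy (toℕ ∘ lexKey h (λ x → x)) (key-injective h)
  sorting : (Fin n → Fin t) → (Fin n → Fin t) × (Fin n → Fin n)
  sorting h = h ∘ σ h , σ h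
  into : ∀ {h} → h ∈ allFuns n t → sorting h ∈[ FunPerm n t ] sortedPairs n t
  into {h} _ = ∈-sortedPairs (sortBy-injective _ (key-injective h)) (sortBy-increasing _ (key-injective h))
  injective : ∀ {h h′} → h ∈ allFuns n t → h′ ∈ allFuns n t →
    sorting h ≈[ FunPerm n t ] sorting h′ → h ≗ h′
  injective {h} {h′} _ _ (hσ≗h′σ′ , σ≗σ′) x
    with injective⇒surjective (sortBy-injective _ (key-injective h)) x
  ... | i , refl = trans (hσ≗h′σ′ i) (cong h′ (sym (σ≗σ′ i)))

module _ {n} (_≺_ : Rel (Fin n) 0ℓ) (_≺?_ : Decidable _≺_) where

  linearExtensions : List (Fin n → Fin n)
  linearExtensions = filter (isLinearExtension? _≺_ _≺?_) (allFuns n n)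

  orderPreserving : ∀ t → List (Fin n → Fin t)
  orderPreserving t = filter (isOrderPreserving? _≺_ _≺?_) (allFuns n t)

  isOrderPreserving-resp-≗ : ∀ {t} {g g′ : Fin n → Fin t} → g ≗ g′ →
    IsOrderPreserving _≺_ _≺?_ g → IsOrderPreserving _≺_ _≺?_ g′
  isOrderPreserving-resp-≗ g≗g′ g-op x y x≺y = subst₂ _≤ᶠ_ (g≗g′ x) (g≗g′ y) (g-op x y x≺y)

  relabelling-≤ : ∀ t → length (cartesianProduct linearExtensions (sortedPairs n t)) ≤
                        length (cartesianProduct (orderPreserving t) (permutations n))
  relabelling-≤ t = length-≤-by-injection (Fun n n ×ₛ FunPerm n t) (FunPerm n t) relabel
    (Unique.cartesianProduct⁺ (Fun n n) (FunPerm n t)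
      (Unique.filter⁺ (Fun n n) (isLinearExtension? _≺_ _≺?_) (allFuns-unique n n)) (sortedPairs-unique n t))
    into injective
    where
    Domain = cartesianProduct linearExtensions (sortedPairs n t)
    relabel : (Fin n → Fin n) × (Fin n → Fin t) × (Fin n → Fin n) → (Fin n → Fin t) × (Fin n → Fin n)
    relabel (L , h , ρ) = h ∘ L , ρ ∘ L
    components : ∀ {L h ρ} → (L , h , ρ) ∈ Domain →
      IsLinearExtension _≺_ _≺?_ L × IsInjection ρ × IsSorted (h , ρ)
    components L,hρ∈ with ∈-cartesianProduct⁻ linearExtensions (sortedPairs n t) L,hρ∈
    ... | L∈ , hρ∈ =
      proj₂ (∈-filter⁻ (isLinearExtension? _≺_ _≺?_) {xs = allFuns n n} L∈) , ∈-sortedPairs⁻ hρ∈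
    into : ∀ {p} → p ∈ Domain → relabel p ∈[ FunPerm n t ] cartesianProduct (orderPreserving t) (permutations n)
    into {L , h , ρ} p∈ with components p∈
    ... | (L-inj , _ , L-mono) , ρ-inj , sorted = Membership.∈-cartesianProduct⁺ (Fun n t) (Fun n n)
      (Membership.∈-filter⁺ (Fun n t) (isOrderPreserving? _≺_ _≺?_) isOrderPreserving-resp-≗
        (∈-allFuns n t (h ∘ L)) (λ x y x≺y → combine-cancelˡ-< (sorted (L-mono x y x≺y))))
      (∈-permutations λ eq → L-inj _ _ (ρ-inj eq))
    injective : ∀ {p q} → p ∈ Domain → q ∈ Domain → relabel p ≈[ FunPerm n t ] relabel q →
      p ≈[ Fun n n ×ₛ FunPerm n t ] q
    injective {L , h , ρ} {L′ , h′ , ρ′} p∈ q∈ (hL≗h′L′ , ρL≗ρ′L′)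
      with components p∈ | components q∈
    ... | (L-inj , L-surj , _) , _ , sorted | (L′-inj , L′-surj , _) , _ , sorted′ =
      L≗L′ , transport h h′ hL≗h′L′ , transport ρ ρ′ ρL≗ρ′L′
      where
      keys≗ : ∀ x → lexKey h ρ (L x) ≡ lexKey h′ ρ′ (L′ x)
      keys≗ x = cong₂ combine (hL≗h′L′ x) (ρL≗ρ′L′ x)
      L≗L′ : L ≗ L′
      L≗L′ = order-equivalent-bijections-≗ (L-inj _ _) L-surj (L′-inj _ _) L′-surj
        (λ {x} {y} → strictlyIncreasing-cancel-< sorted′ ∘ subst₂ _<ᶠ_ (keys≗ x) (keys≗ y) ∘ sorted)
        (λ {x} {y} → strictlyIncreasing-cancel-< sorted
                   ∘ subst₂ _<ᶠ_ (sym (keys≗ x)) (sym (keys≗ y)) ∘ sorted′)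
      transport : ∀ {C : Set} (f f′ : Fin n → C) → f ∘ L ≗ f′ ∘ L′ → f ≗ f′
      transport f f′ fL≗f′L′ k with L-surj k
      ... | x , refl = trans (fL≗f′L′ x) (cong f′ (sym (L≗L′ x)))

-- The argument never uses that ≺ is a strict partial order.
theorem1p4 : (n : ℕ) (_≺_ : Rel (Fin n) 0ℓ) (_≺?_ : Decidable _≺_)
    → IsStrictPartialOrder _≡_ _≺_
    → (t : ℕ)
    → e _≺_ _≺?_ * t ^ n ≤ Ω _≺_ _≺?_ t * (n !)
theorem1p4 n _≺_ _≺?_ _ t = begin
  e _≺_ _≺?_ * t ^ n
    ≤⟨ *-monoʳ-≤ (e _≺_ _≺?_) (t^n≤length-sortedPairs n t) ⟩
  e _≺_ _≺?_ * length (sortedPairs n t)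
    ≡⟨ sym (length-cartesianProductWith _,_ (linearExtensions _≺_ _≺?_) (sortedPairs n t)) ⟩
  length (cartesianProduct (linearExtensions _≺_ _≺?_) (sortedPairs n t))
    ≤⟨ relabelling-≤ _≺_ _≺?_ t ⟩
  length (cartesianProduct (orderPreserving _≺_ _≺?_ t) (permutations n))
    ≡⟨ length-cartesianProductWith _,_ (orderPreserving _≺_ _≺?_ t) (permutations n) ⟩
  Ω _≺_ _≺?_ t * length (permutations n)
    ≤⟨ *-monoʳ-≤ (Ω _≺_ _≺?_ t) (length-permutations n) ⟩
  Ω _≺_ _≺?_ t * n !
    ∎
  where open ℕ.≤-Reasoning
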